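{- Let $T_v$ be a colored rooted ternary tree with root $v$ having exactly two children $w$ and $u$, with root vectors $\mathbf{v},\mathbf{w},\mathbf{u}$ of $T_v,T_w,T_u$. If $\mathbf{w}\geq\mathbf{e}^w=(\varphi^{e^w_s})_{s=0,\dots,3}$ and $\mathbf{u}\geq\mathbf{e}^u=(\varphi^{e^u_s})_{s=0,\dots,3}$ with all $e^w_s,e^u_s\in\mathbb{N}$, then there are $e_0,\dots,e_3\in\mathbb{N}$ such that $\mathbf{v}\geq\mathbf{e}=(\varphi^{e_s})_{s=0,\dots,3}$ and $\Psi(\mathbf{e})=\Psi(\mathbf{e}^w)+\Psi(\mathbf{e}^u)$.
   Context: For a vertex $x$, $T_x$ is the subtree of $x$ and its descendants. $\varphi=(1+\sqrt5)/2$, $\mathbb{N}=\{0,1,2,\dots\}$, $\Psi(\mathbf{e})=2(e_1+e_2+e_3)$ for $\mathbf{e}=(\varphi^{e_s})_{s=0,\dots,3}$; $\geq$ between vectors is componentwise. A colored rooted ternary tree is a rooted tree in which every vertex has at most three children, every non-root vertex $x$ has a label $l_x\in\{1,2,3\}$, and children of a common vertex have distinct labels. Its root vector is defined recursively; for a vertex $x$ let $\mathbf{x}=(x_0,x_1,x_2,x_3)$ denote the root vector of $T_x$. For the root $v$: Rule 0: no children gives $\mathbf{v}=(1,1,1,1)$. Rule 1: exactly one child $a$ gives $\mathbf{v}=(a_1,a_0+a_1,a_3,a_2)$, $(a_1,a_3,a_2,a_0+a_1)$ or $(a_1,a_2,a_0+a_1,a_3)$ according as $l_a=1,2,3$. Rule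 2: for exactly two children named $a,b$ with $(l_a,l_b)\in\{(1,2),(2,3),(3,1)\}$: $\mathbf{v}=(a_1b_1,a_0b_2+a_1b_3,a_3b_2,a_2b_1+a_3b_0)$ if $l_a=1$; $(a_1b_1,a_3b_2,a_3b_0+a_2b_1,a_1b_3+a_0b_2)$ if $l_a=2$; $(a_1b_1,a_3b_0+a_2b_1,a_0b_2+a_1b_3,a_3b_2)$ if $l_a=3$. Rule 3: three children $a,b,c$ labeled $1,2,3$ give $\mathbf{v}=(a_0b_0c_0+a_1b_1c_1,a_0b_2c_3+a_1b_3c_2,a_2b_3c_0+a_3b_2c_1,a_2b_1c_3+a_3b_0c_2)$. -}

module Defs where

open import Data.Nat as ℕ using (ℕ; zero; suc)
open import Data.Integer as ℤ using (ℤ; +_; _-_; -_)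
open import Data.Maybe using (Maybe; just; nothing)
open import Data.Fin using (Fin; zero; suc)
open import Data.Product using (_×_; _,_)
open import Data.Sum using (_⊎_)

-- Exact arithmetic in ℤ[φ] ⊂ ℝ, φ = (1+√5)/2.
-- A pair (a , b) stands for the real number a + b·φ.

ℤφ : Set
ℤφ = ℤ × ℤ

-- Nonnegativity of the real number p + q·√5 (p q ∈ ℤ), √5 > 0.
NonNeg√5 : ℤ → ℤ → Set
NonNeg√5 p q =
    (+ 0 ℤ.≤ p × + 0 ℤ.≤ q)
  ⊎ (+ 0 ℤ.≤ p × q ℤ.< + 0 × + 5 ℤ.* (q ℤ.* q) ℤ.≤ p ℤ.* p)
  ⊎ (p ℤ.< + 0 × + 0 ℤ.< q × p ℤ.* p ℤ.≤ + 5 ℤ.* (q ℤ.* q))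

-- a + b·φ ≥ 0  ⇔  2a + b + b·√5 ≥ 0
NonNegφ : ℤφ → Set
NonNegφ (a , b) = NonNeg√5 (+ 2 ℤ.* a ℤ.+ b) b

-- multiplication by φ:  φ(a + bφ) = b + (a+b)φ  (using φ² = φ + 1)
mulφ : ℤφ → ℤφ
mulφ (a , b) = (b , a ℤ.+ b)

φ^ : ℕ → ℤφ
φ^ zero    = (+ 1 , + 0)
φ^ (suc n) = mulφ (φ^ n)

φ^_≤ℕ_ : ℕ → ℕ → Set
φ^ n ≤ℕ x with φ^ n
... | (a , b) = NonNegφ (+ x - a , - b)

-- Colored rooted ternary trees: the i-th slot holds the child with
-- label i (i = 1,2,3), if present.  So every vertex has at most three
-- children and siblings carry distinct labels.

data Tree : Set where
  node : Maybe Tree → Maybe Tree → Maybe Tree → Tree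

data Label : Set where
  l1 l2 l3 : Label

Vec4 : Set
Vec4 = Fin 4 → ℕ

mk : ℕ → ℕ → ℕ → ℕ → Vec4
mk x0 x1 x2 x3 zero = x0
mk x0 x1 x2 x3 (suc zero) = x1
mk x0 x1 x2 x3 (suc (suc zero)) = x2
mk x0 x1 x2 x3 (suc (suc (suc zero))) = x3

private
  _*_ = ℕ._*_
  _+_ = ℕ._+_
  infixl 7 _*_
  infixl 6 _+_

  i0 i1 i2 i3 : Fin 4
  i0 = zero
  i1 = suc zero
  i2 = suc (suc zero)
  i3 = suc (suc (suc zero))

rule1 : Label → Vec4 → Vec4
rule1 l1 a = mk (a i1) (a i0 + a i1) (a i3) (a i2)
rule1 l2 a = mk (a i1) (a i3) (a i2) (a i0 + a i1)
rule1 l3 a = mk (a i1) (a i2) (a i0 + a i1) (a i3)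

-- Rule 2 (children a, b with (l_a , l_b) ∈ {(1,2),(2,3),(3,1)}; here l = l_a)
rule2 : Label → Vec4 → Vec4 → Vec4
rule2 l1 a b = mk (a i1 * b i1) (a i0 * b i2 + a i1 * b i3) (a i3 * b i2) (a i2 * b i1 + a i3 * b i0)
rule2 l2 a b = mk (a i1 * b i1) (a i3 * b i2) (a i3 * b i0 + a i2 * b i1) (a i1 * b i3 + a i0 * b i2)
rule2 l3 a b = mk (a i1 * b i1) (a i3 * b i0 + a i2 * b i1) (a i0 * b i2 + a i1 * b i3) (a i3 * b i2)

rule3 : Vec4 → Vec4 → Vec4 → Vec4
rule3 a b c = mk (a i0 * b i0 * c i0 + a i1 * b i1 * c i1)
                 (a i0 * b i2 * c i3 + a i1 * b i3 * c i2)
                 (a i2 * b i3 * c i0 + a i3 * b i2 * c i1)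
                 (a i2 * b i1 * c i3 + a i3 * b i0 * c i2)

rootVec : Tree → Vec4
rootVec (node nothing  nothing  nothing)  = mk 1 1 1 1
rootVec (node (just a) nothing  nothing)  = rule1 l1 (rootVec a)
rootVec (node nothing  (just b) nothing)  = rule1 l2 (rootVec b)
rootVec (node nothing  nothing  (just c)) = rule1 l3 (rootVec c)
rootVec (node (just a) (just b) nothing)  = rule2 l1 (rootVec a) (rootVec b)
rootVec (node nothing  (just b) (just c)) = rule2 l2 (rootVec b) (rootVec c)
rootVec (node (just a) nothing  (just c)) = rule2 l3 (rootVec c) (rootVec a)
rootVec (node (just a) (just b) (just c)) = rule3 (rootVec a) (rootVec b) (rootVec c)

-- The tree whose root has exactly the two children w (label lw) and
-- u (label lu); meaningful when lw ≢ lu.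
slot : Label → Label → Tree → Label → Tree → Maybe Tree
slot l1 l1 w _ _ = just w
slot l2 l2 w _ _ = just w
slot l3 l3 w _ _ = just w
slot l1 _ _ l1 u = just u
slot l2 _ _ l2 u = just u
slot l3 _ _ l3 u = just u
slot _ _ _ _ _ = nothing

twoChildren : Label → Tree → Label → Tree → Tree
twoChildren lw w lu u = node (slot l1 lw w lu u) (slot l2 lw w lu u) (slot l3 lw w lu u)

Exps : Set
Exps = Fin 4 → ℕ

_≥φ^_ : Vec4 → Exps → Set
x ≥φ^ e = ∀ s → φ^ (e s) ≤ℕ (x s)

Ψ : Exps → ℕ
Ψ e = 2 * (e i1 + e i2 + e i3)

-- Each coordinate of Rule 2 contains a product aᵢbⱼ; in coordinates 1–3 the
-- index pairs are (1,3), (3,2), (2,1) in some order, so taking eʷᵢ + eᵘⱼ there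
-- makes Ψ additive. What remains is φᵐ ≤ x, φⁿ ≤ y ⇒ φᵐ⁺ⁿ ≤ xy, proved exactly
-- in ℕ: as 2φⁿ = Lₙ + Fₙ√5 (Lucas and Fibonacci numbers), φⁿ ≤ x means
-- 2x = Lₙ + u with u ≥ Fₙ√5, and this form survives products by the addition
-- formulas 2Lₘ₊ₙ = LₘLₙ + 5FₘFₙ and 2Fₘ₊ₙ = FₘLₙ + LₘFₙ.
module Submission where

open import Defs
open import Data.Nat using (ℕ; _+_)
open import Data.Product using (Σ; _×_)
open import Relation.Binary.PropositionalEquality using (_≡_; _≢_)

open import Algebra.Properties.AbelianGroup using (∙-cancelʳ)
open import Data.Empty using (⊥-elim)
open import Data.Fin using (zero; suc; #_)
open import Data.Integer as ℤ using (+_; +≤+; +<+; -<+)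
import Data.Integer.Properties as ℤP
import Data.Integer.Tactic.RingSolver as ℤSolver
open import Data.List using ([]; _∷_)
open import Data.Nat using (zero; suc; _*_; _∸_; _≤_; z≤n; NonZero)
open import Data.Nat.Properties
open import Data.Nat.Tactic.RingSolver using (solve-∀; solve)
open import Data.Product using (∃-syntax; _,_)
open import Data.Sum using (inj₁; inj₂)
open import Function using (id)
open import Relation.Binary.PropositionalEquality
  using (refl; sym; trans; cong; cong₂; subst; subst₂; module ≡-Reasoning)

infix 4 √5·_≤_

record √5·_≤_ (t s : ℕ) : Set where
  constructor √5≤
  field squares : 5 * (t * t) ≤ s * s

m*m≤n*n⇒m≤n : ∀ m n → m * m ≤ n * n → m ≤ n
m*m≤n*n⇒m≤n m n sq = ≮⇒≥ (λ n<m → <⇒≱ (*-mono-< n<m n<m) sq)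

√5·-*-≤ : ∀ {t₁ s₁ t₂ s₂} → √5· t₁ ≤ s₁ → √5· t₂ ≤ s₂ → 5 * (t₁ * t₂) ≤ s₁ * s₂
√5·-*-≤ {t₁} {s₁} {t₂} {s₂} (√5≤ h₁) (√5≤ h₂) = m*m≤n*n⇒m≤n _ _ (begin
  (5 * (t₁ * t₂)) * (5 * (t₁ * t₂))  ≡⟨ solve (t₁ ∷ t₂ ∷ []) ⟩
  (5 * (t₁ * t₁)) * (5 * (t₂ * t₂))  ≤⟨ *-mono-≤ h₁ h₂ ⟩
  (s₁ * s₁) * (s₂ * s₂)              ≡⟨ solve (s₁ ∷ s₂ ∷ []) ⟩
  (s₁ * s₂) * (s₁ * s₂)              ∎)
  where open ≤-Reasoning

√5·-+ : ∀ {t₁ s₁ t₂ s₂} → √5· t₁ ≤ s₁ → √5· t₂ ≤ s₂ → √5· t₁ + t₂ ≤ s₁ + s₂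
√5·-+ {t₁} {s₁} {t₂} {s₂} p₁@(√5≤ h₁) p₂@(√5≤ h₂) = √5≤ (begin
  5 * ((t₁ + t₂) * (t₁ + t₂))                           ≡⟨ solve (t₁ ∷ t₂ ∷ []) ⟩
  5 * (t₁ * t₁) + 5 * (t₂ * t₂) + 2 * (5 * (t₁ * t₂))  ≤⟨ +-mono-≤ (+-mono-≤ h₁ h₂) (*-monoʳ-≤ 2 (√5·-*-≤ p₁ p₂)) ⟩
  s₁ * s₁ + s₂ * s₂ + 2 * (s₁ * s₂)                     ≡⟨ solve (s₁ ∷ s₂ ∷ []) ⟩
  (s₁ + s₂) * (s₁ + s₂)                                 ∎)
  where open ≤-Reasoning

√5·-*ʳ : ∀ {t s} c → √5· t ≤ s → √5· t * c ≤ s * c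
√5·-*ʳ {t} {s} c (√5≤ h) = √5≤ (begin
  5 * ((t * c) * (t * c))  ≡⟨ solve (t ∷ c ∷ []) ⟩
  5 * (t * t) * (c * c)    ≤⟨ *-monoˡ-≤ (c * c) h ⟩
  s * s * (c * c)          ≡⟨ solve (s ∷ c ∷ []) ⟩
  (s * c) * (s * c)        ∎)
  where open ≤-Reasoning

√5·-*ˡ-cancel : ∀ {t s} c .{{_ : NonZero c}} → √5· c * t ≤ c * s → √5· t ≤ s
√5·-*ˡ-cancel {t} {s} c (√5≤ h) = √5≤ (*-cancelˡ-≤ (c * c) {{m*n≢0 c c}} (begin
  c * c * (5 * (t * t))    ≡⟨ solve (c ∷ t ∷ []) ⟩
  5 * ((c * t) * (c * t))  ≤⟨ h ⟩
  (c * s) * (c * s)        ≡⟨ solve (c ∷ s ∷ []) ⟩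
  c * c * (s * s)          ∎))
  where open ≤-Reasoning

√5·-monoʳ : ∀ {t s s′} → √5· t ≤ s → s ≤ s′ → √5· t ≤ s′
√5·-monoʳ (√5≤ h) s≤s′ = √5≤ (≤-trans h (*-mono-≤ s≤s′ s≤s′))

-- φⁿ = fib₋₁ n + fib n · φ, where fib₋₁ n is the Fibonacci number Fₙ₋₁ (with F₋₁ = 1).
fib₋₁ fib : ℕ → ℕ
fib₋₁ zero    = 1
fib₋₁ (suc n) = fib n
fib zero    = 0
fib (suc n) = fib₋₁ n + fib n

φ^-coeffs : ∀ n → φ^ n ≡ (+ fib₋₁ n , + fib n)
φ^-coeffs zero = refl
φ^-coeffs (suc n) rewrite φ^-coeffs n = refl

fib₋₁-+ : ∀ m n → fib₋₁ (m + n) ≡ fib₋₁ m * fib₋₁ n + fib m * fib n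
fib-+   : ∀ m n → fib (m + n) ≡ fib₋₁ m * fib n + fib m * fib₋₁ n + fib m * fib n
fib₋₁-+ zero n = identity (fib₋₁ n) (fib n)
  where
  identity : ∀ a b → a ≡ 1 * a + 0 * b
  identity = solve-∀
fib₋₁-+ (suc m) n rewrite fib-+ m n = identity (fib₋₁ m) (fib m) (fib₋₁ n) (fib n)
  where
  identity : ∀ a b c d → a * d + b * c + b * d ≡ b * c + (a + b) * d
  identity = solve-∀
fib-+ zero n = identity (fib₋₁ n) (fib n)
  where
  identity : ∀ a b → b ≡ 1 * b + 0 * a + 0 * b
  identity = solve-∀
fib-+ (suc m) n rewrite fib₋₁-+ m n | fib-+ m n = identity (fib₋₁ m) (fib m) (fib₋₁ n) (fib n)
  where
  identity : ∀ a b c d → a * c + b * d + (a * d + b * c + b * d) ≡ b * d + (a + b) * c + (a + b) * d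
  identity = solve-∀

lucas : ℕ → ℕ
lucas n = 2 * fib₋₁ n + fib n

lucas-+ : ∀ m n → 2 * lucas (m + n) ≡ lucas m * lucas n + 5 * (fib m * fib n)
lucas-+ m n = trans (cong₂ (λ a b → 2 * (2 * a + b)) (fib₋₁-+ m n) (fib-+ m n))
                    (identity (fib₋₁ m) (fib m) (fib₋₁ n) (fib n))
  where
  identity : ∀ a b c d → 2 * (2 * (a * c + b * d) + (a * d + b * c + b * d))
                       ≡ (2 * a + b) * (2 * c + d) + 5 * (b * d)
  identity = solve-∀

fib-+-lucas : ∀ m n → 2 * fib (m + n) ≡ fib m * lucas n + fib n * lucas m
fib-+-lucas m n = trans (cong (2 *_) (fib-+ m n)) (identity (fib₋₁ m) (fib m) (fib₋₁ n) (fib n))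
  where
  identity : ∀ a b c d → 2 * (a * d + b * c + b * d) ≡ b * (2 * c + d) + d * (2 * a + b)
  identity = solve-∀

NonNeg√5-neg⇒ : ∀ {p} t → NonNeg√5 p (ℤ.- + t) → ∃[ s ] p ≡ + s × √5· t ≤ s
NonNeg√5-neg⇒ zero (inj₁ (+≤+ _ , _)) = _ , refl , √5≤ z≤n
NonNeg√5-neg⇒ zero (inj₂ (inj₁ (_ , +<+ () , _)))
NonNeg√5-neg⇒ zero (inj₂ (inj₂ (_ , +<+ () , _)))
NonNeg√5-neg⇒ (suc t) (inj₁ (_ , ()))
NonNeg√5-neg⇒ (suc t) (inj₂ (inj₁ (+≤+ {n = s} _ , _ , sq))) =
  s , refl , √5≤ (ℤP.drop‿+≤+ (subst₂ ℤ._≤_ (sym (ℤP.pos-* 5 (suc t * suc t))) (sym (ℤP.pos-* s s)) sq))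
NonNeg√5-neg⇒ (suc t) (inj₂ (inj₂ (_ , () , _)))

NonNeg√5-neg⇐ : ∀ {s} t → √5· t ≤ s → NonNeg√5 (+ s) (ℤ.- + t)
NonNeg√5-neg⇐ zero    _ = inj₁ (+≤+ z≤n , +≤+ z≤n)
NonNeg√5-neg⇐ {s} (suc t) (√5≤ sq) =
  inj₂ (inj₁ (+≤+ z≤n , -<+ , subst₂ ℤ._≤_ (ℤP.pos-* 5 (suc t * suc t)) (ℤP.pos-* s s) (+≤+ sq)))

φ^-≤ℕ-unfold : ∀ n x →
  (φ^ n ≤ℕ x) ≡ NonNeg√5 (+ 2 ℤ.* (+ x ℤ.- + fib₋₁ n) ℤ.+ ℤ.- + fib n) (ℤ.- + fib n)
φ^-≤ℕ-unfold n x rewrite φ^-coeffs n = refl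

module _ (x g h : ℕ) where

  private
    p = + 2 ℤ.* (+ x ℤ.- + g) ℤ.+ ℤ.- + h
    k = 2 * g + h

  excess-+ : p ℤ.+ + k ≡ + (2 * x)
  excess-+ = begin
    p ℤ.+ + k                    ≡⟨ cong (λ z → p ℤ.+ z) (trans (ℤP.pos-+ (2 * g) h) (cong (λ z → z ℤ.+ + h) (ℤP.pos-* 2 g))) ⟩
    p ℤ.+ (+ 2 ℤ.* + g ℤ.+ + h)  ≡⟨ identity (+ x) (+ g) (+ h) ⟩
    + 2 ℤ.* + x                  ≡⟨ ℤP.pos-* 2 x ⟨
    + (2 * x)                    ∎
    where
    open ≡-Reasoning
    identity : ∀ X G H → + 2 ℤ.* (X ℤ.- G) ℤ.+ ℤ.- H ℤ.+ (+ 2 ℤ.* G ℤ.+ H) ≡ + 2 ℤ.* X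
    identity = ℤSolver.solve-∀

  excess⇒ : ∀ {u} → p ≡ + u → 2 * x ≡ k + u
  excess⇒ {u} p≡u = ℤP.+-injective (begin
    + (2 * x)    ≡⟨ excess-+ ⟨
    p ℤ.+ + k    ≡⟨ cong (λ z → z ℤ.+ + k) p≡u ⟩
    + u ℤ.+ + k  ≡⟨ ℤP.pos-+ u k ⟨
    + (u + k)    ≡⟨ cong +_ (+-comm u k) ⟩
    + (k + u)    ∎)
    where open ≡-Reasoning

  excess⇐ : ∀ {u} → 2 * x ≡ k + u → p ≡ + u
  excess⇐ {u} 2x≡ = ∙-cancelʳ ℤP.+-0-abelianGroup (+ k) p (+ u) (begin
    p ℤ.+ + k    ≡⟨ excess-+ ⟩
    + (2 * x)    ≡⟨ cong +_ (trans 2x≡ (+-comm k u)) ⟩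
    + (u + k)    ≡⟨ ℤP.pos-+ u k ⟩
    + u ℤ.+ + k  ∎)
    where open ≡-Reasoning

-- Since 2φⁿ = lucas n + fib n · √5, this is φⁿ ≤ x.
infix 4 φ^_≤′_

record φ^_≤′_ (n x : ℕ) : Set where
  constructor bound
  field
    excess       : ℕ
    double-≡     : 2 * x ≡ lucas n + excess
    excess-bound : √5· fib n ≤ excess

≤ℕ⇒≤′ : ∀ n x → φ^ n ≤ℕ x → φ^ n ≤′ x
≤ℕ⇒≤′ n x h with NonNeg√5-neg⇒ (fib n) (subst id (φ^-≤ℕ-unfold n x) h)
... | u , p≡u , u-bound = bound u (excess⇒ x (fib₋₁ n) (fib n) p≡u) u-bound

≤′⇒≤ℕ : ∀ {n x} → φ^ n ≤′ x → φ^ n ≤ℕ x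
≤′⇒≤ℕ {n} {x} (bound u 2x≡ u-bound) =
  subst id (sym (φ^-≤ℕ-unfold n x))
    (subst (λ p → NonNeg√5 p (ℤ.- + fib n)) (sym (excess⇐ x (fib₋₁ n) (fib n) 2x≡))
      (NonNeg√5-neg⇐ (fib n) u-bound))

≤′-mono : ∀ {n x y} → φ^ n ≤′ x → x ≤ y → φ^ n ≤′ y
≤′-mono {n} {x} {y} (bound u 2x≡ u-bound) x≤y =
  bound (u + 2 * (y ∸ x)) 2y≡ (√5·-monoʳ u-bound (m≤m+n u _))
  where
  2y≡ : 2 * y ≡ lucas n + (u + 2 * (y ∸ x))
  2y≡ = begin
    2 * y                          ≡⟨ cong (2 *_) (m+[n∸m]≡n x≤y) ⟨
    2 * (x + (y ∸ x))              ≡⟨ *-distribˡ-+ 2 x (y ∸ x) ⟩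
    2 * x + 2 * (y ∸ x)            ≡⟨ cong (_+ 2 * (y ∸ x)) 2x≡ ⟩
    lucas n + u + 2 * (y ∸ x)      ≡⟨ +-assoc (lucas n) u _ ⟩
    lucas n + (u + 2 * (y ∸ x))    ∎
    where open ≡-Reasoning

halve-excess : ∀ {a b c} → 2 * a ≡ 2 * b + c → ∃[ w ] a ≡ b + w × c ≡ 2 * w
halve-excess {a} {b} {c} 2a≡ = a ∸ b , sym (m+[n∸m]≡n b≤a) , +-cancelˡ-≡ (2 * b) c (2 * (a ∸ b)) (begin
  2 * b + c            ≡⟨ 2a≡ ⟨
  2 * a                ≡⟨ cong (2 *_) (m+[n∸m]≡n b≤a) ⟨
  2 * (b + (a ∸ b))    ≡⟨ *-distribˡ-+ 2 b (a ∸ b) ⟩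
  2 * b + 2 * (a ∸ b)  ∎)
  where
  open ≡-Reasoning
  b≤a : b ≤ a
  b≤a = *-cancelˡ-≤ 2 (subst (2 * b ≤_) (sym 2a≡) (m≤m+n (2 * b) c))

≤′-* : ∀ {m n x y} → φ^ m ≤′ x → φ^ n ≤′ y → φ^ m + n ≤′ x * y
≤′-* {m} {n} {x} {y} (bound u 2x≡ u-bound) (bound v 2y≡ v-bound) =
  let w , 2xy≡ , excess₂≡2w = halve-excess {b = lucas (m + n)} 4xy≡
  in  bound w 2xy≡ (√5·-*ˡ-cancel 2 (subst (√5· 2 * fib (m + n) ≤_) excess₂≡2w excess₂-bound))
  where
  r = u * v ∸ 5 * (fib m * fib n)
  cross = u * lucas n + v * lucas m
  excess₂ = cross + r
  uv≡ : u * v ≡ 5 * (fib m * fib n) + r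
  uv≡ = sym (m+[n∸m]≡n (√5·-*-≤ u-bound v-bound))
  4xy≡ : 2 * (2 * (x * y)) ≡ 2 * lucas (m + n) + excess₂
  4xy≡ = begin
    2 * (2 * (x * y))                                          ≡⟨ solve (x ∷ y ∷ []) ⟩
    (2 * x) * (2 * y)                                          ≡⟨ cong₂ _*_ 2x≡ 2y≡ ⟩
    (lucas m + u) * (lucas n + v)                              ≡⟨ expand (lucas m) u (lucas n) v ⟩
    lucas m * lucas n + cross + u * v                          ≡⟨ cong (λ z → lucas m * lucas n + cross + z) uv≡ ⟩
    lucas m * lucas n + cross + (5 * (fib m * fib n) + r)      ≡⟨ regroup (lucas m * lucas n) cross (5 * (fib m * fib n)) r ⟩
    lucas m * lucas n + 5 * (fib m * fib n) + excess₂          ≡⟨ cong (_+ excess₂) (lucas-+ m n) ⟨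
    2 * lucas (m + n) + excess₂                                ∎
    where
    open ≡-Reasoning
    expand : ∀ a b c d → (a + b) * (c + d) ≡ a * c + (b * c + d * a) + b * d
    expand = solve-∀
    regroup : ∀ a b c d → a + b + (c + d) ≡ a + c + (b + d)
    regroup = solve-∀
  excess₂-bound : √5· 2 * fib (m + n) ≤ excess₂
  excess₂-bound = subst (√5·_≤ excess₂) (sym (fib-+-lucas m n))
    (√5·-monoʳ (√5·-+ (√5·-*ʳ (lucas n) u-bound) (√5·-*ʳ (lucas m) v-bound)) (m≤m+n _ r))

infix 4 _≥φ^′_

_≥φ^′_ : Vec4 → Exps → Set
x ≥φ^′ e = ∀ s → φ^ e s ≤′ x s

≥φ^⇒≥φ^′ : ∀ x e → x ≥φ^ e → x ≥φ^′ e
≥φ^⇒≥φ^′ x e x≥e s = ≤ℕ⇒≤′ (e s) (x s) (x≥e s)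

≥φ^′⇒≥φ^ : ∀ x e → x ≥φ^′ e → x ≥φ^ e
≥φ^′⇒≥φ^ x e x≥e s = ≤′⇒≤ℕ (x≥e s)

≤′-+ʳ : ∀ {n x y} → φ^ n ≤′ x → φ^ n ≤′ x + y
≤′-+ʳ h = ≤′-mono h (m≤m+n _ _)

≤′-+ˡ : ∀ {n x y} → φ^ n ≤′ y → φ^ n ≤′ x + y
≤′-+ˡ h = ≤′-mono h (m≤n+m _ _)

rule2-exps : Label → Exps → Exps → Exps
rule2-exps l1 a b = mk (a (# 1) + b (# 1)) (a (# 1) + b (# 3)) (a (# 3) + b (# 2)) (a (# 2) + b (# 1))
rule2-exps l2 a b = mk (a (# 1) + b (# 1)) (a (# 3) + b (# 2)) (a (# 2) + b (# 1)) (a (# 1) + b (# 3))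
rule2-exps l3 a b = mk (a (# 1) + b (# 1)) (a (# 2) + b (# 1)) (a (# 1) + b (# 3)) (a (# 3) + b (# 2))

rule2-≥φ^′ : ∀ l {A B ea eb} → A ≥φ^′ ea → B ≥φ^′ eb → rule2 l A B ≥φ^′ rule2-exps l ea eb
rule2-≥φ^′ l1 a b zero                   = ≤′-* (a (# 1)) (b (# 1))
rule2-≥φ^′ l1 a b (suc zero)             = ≤′-+ˡ (≤′-* (a (# 1)) (b (# 3)))
rule2-≥φ^′ l1 a b (suc (suc zero))       = ≤′-* (a (# 3)) (b (# 2))
rule2-≥φ^′ l1 a b (suc (suc (suc zero))) = ≤′-+ʳ (≤′-* (a (# 2)) (b (# 1)))
rule2-≥φ^′ l2 a b zero                   = ≤′-* (a (# 1)) (b (# 1))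
rule2-≥φ^′ l2 a b (suc zero)             = ≤′-* (a (# 3)) (b (# 2))
rule2-≥φ^′ l2 a b (suc (suc zero))       = ≤′-+ˡ (≤′-* (a (# 2)) (b (# 1)))
rule2-≥φ^′ l2 a b (suc (suc (suc zero))) = ≤′-+ʳ (≤′-* (a (# 1)) (b (# 3)))
rule2-≥φ^′ l3 a b zero                   = ≤′-* (a (# 1)) (b (# 1))
rule2-≥φ^′ l3 a b (suc zero)             = ≤′-+ˡ (≤′-* (a (# 2)) (b (# 1)))
rule2-≥φ^′ l3 a b (suc (suc zero))       = ≤′-+ˡ (≤′-* (a (# 1)) (b (# 3)))
rule2-≥φ^′ l3 a b (suc (suc (suc zero))) = ≤′-* (a (# 3)) (b (# 2))

Ψ-rule2-exps : ∀ l ea eb → Ψ (rule2-exps l ea eb) ≡ Ψ ea + Ψ eb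
Ψ-rule2-exps l1 ea eb = identity (ea (# 1)) (ea (# 2)) (ea (# 3)) (eb (# 1)) (eb (# 2)) (eb (# 3))
  where
  identity : ∀ a₁ a₂ a₃ b₁ b₂ b₃ →
    2 * ((a₁ + b₃) + (a₃ + b₂) + (a₂ + b₁)) ≡ 2 * (a₁ + a₂ + a₃) + 2 * (b₁ + b₂ + b₃)
  identity = solve-∀
Ψ-rule2-exps l2 ea eb = identity (ea (# 1)) (ea (# 2)) (ea (# 3)) (eb (# 1)) (eb (# 2)) (eb (# 3))
  where
  identity : ∀ a₁ a₂ a₃ b₁ b₂ b₃ →
    2 * ((a₃ + b₂) + (a₂ + b₁) + (a₁ + b₃)) ≡ 2 * (a₁ + a₂ + a₃) + 2 * (b₁ + b₂ + b₃)
  identity = solve-∀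
Ψ-rule2-exps l3 ea eb = identity (ea (# 1)) (ea (# 2)) (ea (# 3)) (eb (# 1)) (eb (# 2)) (eb (# 3))
  where
  identity : ∀ a₁ a₂ a₃ b₁ b₂ b₃ →
    2 * ((a₂ + b₁) + (a₁ + b₃) + (a₃ + b₂)) ≡ 2 * (a₁ + a₂ + a₃) + 2 * (b₁ + b₂ + b₃)
  identity = solve-∀

Dominates : Vec4 → ℕ → Set
Dominates x k = Σ Exps (λ e → (x ≥φ^ e) × (Ψ e ≡ k))

rule2-dominates : ∀ l A B ea eb → A ≥φ^ ea → B ≥φ^ eb → Dominates (rule2 l A B) (Ψ ea + Ψ eb)
rule2-dominates l A B ea eb A≥ea B≥eb =
  rule2-exps l ea eb ,
  ≥φ^′⇒≥φ^ (rule2 l A B) (rule2-exps l ea eb)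
    (rule2-≥φ^′ l (≥φ^⇒≥φ^′ A ea A≥ea) (≥φ^⇒≥φ^′ B eb B≥eb)) ,
  Ψ-rule2-exps l ea eb

rule2-dominatesᶜ : ∀ l A B ea eb → A ≥φ^ ea → B ≥φ^ eb → Dominates (rule2 l A B) (Ψ eb + Ψ ea)
rule2-dominatesᶜ l A B ea eb A≥ea B≥eb =
  subst (Dominates (rule2 l A B)) (+-comm (Ψ ea) (Ψ eb)) (rule2-dominates l A B ea eb A≥ea B≥eb)

lemma19 : (lw lu : Label) → lw ≢ lu → (w u : Tree) → (ew eu : Exps) →
          rootVec w ≥φ^ ew → rootVec u ≥φ^ eu →
          Σ Exps (λ e → (rootVec (twoChildren lw w lu u) ≥φ^ e) × (Ψ e ≡ Ψ ew + Ψ eu))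
lemma19 l1 l2 _ w u ew eu w≥ew u≥eu = rule2-dominates  l1 (rootVec w) (rootVec u) ew eu w≥ew u≥eu
lemma19 l2 l3 _ w u ew eu w≥ew u≥eu = rule2-dominates  l2 (rootVec w) (rootVec u) ew eu w≥ew u≥eu
lemma19 l3 l1 _ w u ew eu w≥ew u≥eu = rule2-dominates  l3 (rootVec w) (rootVec u) ew eu w≥ew u≥eu
lemma19 l2 l1 _ w u ew eu w≥ew u≥eu = rule2-dominatesᶜ l1 (rootVec u) (rootVec w) eu ew u≥eu w≥ew
lemma19 l3 l2 _ w u ew eu w≥ew u≥eu = rule2-dominatesᶜ l2 (rootVec u) (rootVec w) eu ew u≥eu w≥ew
lemma19 l1 l3 _ w u ew eu w≥ew u≥eu = rule2-dominatesᶜ l3 (rootVec u) (rootVec w) eu ew u≥eu w≥ew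
lemma19 l1 l1 l≢l _ _ _ _ _ _ = ⊥-elim (l≢l refl)
lemma19 l2 l2 l≢l _ _ _ _ _ _ = ⊥-elim (l≢l refl)
lemma19 l3 l3 l≢l _ _ _ _ _ _ = ⊥-elim (l≢l refl)
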